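{- Let $r\ge2$, $k\ge2$, $\ell\ge2$, let $P$ be a collectable $r$-pattern whose composition has $s$ components, and let $\pi$ be a partition $[s]=T_0\cup\cdots\cup T_t$ into nonempty parts with $1\in T_0$. Then every scattered matching in the ordered $\ell$-blow-up $H_k(P,\pi)^{(\ell)}$ is a $\mathcal{C}(P,\pi)$-clique.
   Context: An ordered $m$-matching of size $k$ is a set of $k$ pairwise disjoint $m$-element subsets (edges) of a linearly ordered set of $mk$ vertices; two ordered hypergraphs are order-isomorphic if there is an order-preserving isomorphism. An $r$-pattern is an ordered $r$-matching of size 2 (up to order-isomorphism), written as a word of length $2r$ in $A,B$, each occurring $r$ times, beginning with $A$ (words differing by $A\leftrightarrow B$ are the same pattern). $P$ is collectable if it splits uniquely into consecutive blocks $P=S_1\cdots S_s$ of the form $A^tB^t$ or $B^tA^t$ ($t\ge1$ depending on the block); $\lambda_i=|S_i|/2$. The mega-block $P_j$ is the $r_j$-pattern ($r_j=\sum_{i\in T_j}\lambda_i$) formed by concatenating the blocks $S_i$, $i\in T_j$. For $F\subseteq[t]$, $P_F$ is obtained from $P$ by exchanging $A\leftrightarrow B$ in all positions of the mega-blocks $P_j$, $j\in F$, and $\mathcal{C}(P,\pi)=\{P_F:F\subseteq[t]\}$. For a set $\mathcal{P}$ of patterns, a $\mathcal{P}$-clique is an ordered matching in which every pair of edges is order-isomorphic to a member of $\mathcal{P}$; for a collectable pattern $Q$ there is exactly one $Q$-clique of size $k$ on a given ordered vertex set of the right size. The hypergraph $H_k(P,\pi)$: take a linearly ordered set $V$ of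 $kr$ vertices split into consecutive blocks $V_1,\dots,V_s$ with $|V_i|=k\lambda_i$; let $U_j=\bigcup_{i\in T_j}V_i$ and let $K_j$ be the unique $P_j$-clique of size $k$ on $U_j$; $H_k(P,\pi)$ has vertex set $V$ and edges $e_0\cup\cdots\cup e_t$ with $e_j\in K_j$. The ordered $\ell$-blow-up $H^{(\ell)}$ of an ordered hypergraph $H$ replaces each vertex $u$ by a set $W_u$ of $\ell$ new vertices (pairwise disjoint), with all vertices of $W_u$ preceding all vertices of $W_w$ whenever $u<w$, and replaces each edge $\{u_1,\dots,u_r\}$ by all $r$-sets having exactly one vertex in each of $W_{u_1},\dots,W_{u_r}$. A matching $M\subseteq H^{(\ell)}$ (set of pairwise disjoint edges) is scattered if $|V(M)\cap W_u|\le1$ for every vertex $u$ of $H$. -}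

module Defs where

open import Data.Nat using (ℕ; zero; suc; _+_; _*_; _≤_; _<_; _<ᵇ_)
open import Data.Fin using (Fin; toℕ) renaming (_≟_ to _≟F_)
open import Data.List using (List; []; _∷_; _++_; map; concatMap; length; take; lookup; replicate; allFin)
open import Data.Nat.ListAction using (sum)
open import Data.List.Membership.Propositional using (_∈_)
open import Data.List.Relation.Unary.All using (All)
open import Data.List.Relation.Unary.Linked using (Linked)
open import Data.List.Relation.Binary.Pointwise using (Pointwise)
open import Data.Product using (Σ; ∃; _×_; _,_; proj₂)
open import Data.Sum using (_⊎_)
open import Data.Bool using (Bool; true; false; if_then_else_)
open import Data.Empty using (⊥)
open import Relation.Binary.PropositionalEquality using (_≡_; _≢_)
open import Relation.Nullary.Decidable using (⌊_⌋)

data Letter : Set where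
  A B : Letter

swapL : Letter → Letter
swapL A = B
swapL B = A

Word : Set
Word = List Letter

countA : Word → ℕ
countA []      = 0
countA (A ∷ w) = suc (countA w)
countA (B ∷ w) = countA w

IsPattern : ℕ → Word → Set
IsPattern r P = (length P ≡ r + r) × (countA P ≡ r) × (∃ λ w → P ≡ A ∷ w)

-- Collectable patterns: blocks A^t B^t or B^t A^t

Block : Set
Block = Letter × ℕ

blockWord : Block → Word
blockWord (x , t) = replicate t x ++ replicate t (swapL x)

lam : Block → ℕ
lam = proj₂

IsSplit : Word → List Block → Set
IsSplit P bs = All (λ b → 1 ≤ lam b) bs × (concatMap blockWord bs ≡ P)

-- Partitions π : [s] = T_0 ∪ … ∪ T_t, given by the part-index of each block.
-- Blocks are indexed by Fin (length bs) (index 0 is the paper's block 1).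

flipIf : Bool → Word → Word
flipIf true  w = map swapL w
flipIf false w = w

-- F ⊆ [t] = {1,…,t} as a characteristic function; part 0 is never flipped
isFlipped : ∀ {t} → (Fin t → Bool) → Fin (suc t) → Bool
isFlipped F Fin.zero    = false
isFlipped F (Fin.suc j) = F j

flipPattern : (bs : List Block) {t : ℕ} → (Fin (length bs) → Fin (suc t)) → (Fin t → Bool) → Word
flipPattern bs π F =
  concatMap (λ i → flipIf (isFlipped F (π i)) (blockWord (lookup bs i))) (allFin (length bs))

CP : (bs : List Block) {t : ℕ} → (Fin (length bs) → Fin (suc t)) → Word → Set
CP bs {t} π Q = ∃ λ (F : Fin t → Bool) → Q ≡ flipPattern bs π F

megaBlock : (bs : List Block) {t : ℕ} → (Fin (length bs) → Fin (suc t)) → Fin (suc t) → Word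
megaBlock bs π j =
  concatMap (λ i → if ⌊ π i ≟F j ⌋ then blockWord (lookup bs i) else []) (allFin (length bs))

rj : (bs : List Block) {t : ℕ} → (Fin (length bs) → Fin (suc t)) → Fin (suc t) → ℕ
rj bs π j = sum (map (λ i → if ⌊ π i ≟F j ⌋ then lam (lookup bs i) else 0) (allFin (length bs)))

-- Ordered hypergraphs: vertices are natural numbers with their usual order;
-- an edge is a strictly increasing list of vertices; a matching is a list of
-- edges, pairwise disjoint.

Edge : Set
Edge = List ℕ

Disjoint : Edge → Edge → Set
Disjoint e f = ∀ x → x ∈ e → x ∈ f → ⊥

IsMatching : List Edge → Set
IsMatching M = All (Linked _<_) M
             × (∀ a b → a ≢ b → Disjoint (lookup M a) (lookup M b))

-- the word of the ordered pair (e , f) of disjoint sorted edges: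
-- read the union in increasing order, writing A for vertices of e, B for f.
pairWord : Edge → Edge → Word
pairWord []       ys       = map (λ _ → B) ys
pairWord (x ∷ xs) []       = map (λ _ → A) (x ∷ xs)
pairWord (x ∷ xs) (y ∷ ys) =
  if x <ᵇ y then A ∷ pairWord xs (y ∷ ys) else B ∷ pairWord (x ∷ xs) ys

-- {e , f} is order-isomorphic to the pattern Q (patterns are taken up to A↔B)
HasPattern : Edge → Edge → Word → Set
HasPattern e f Q = (pairWord e f ≡ Q) ⊎ (pairWord f e ≡ Q)

IsClique : (Word → Set) → List Edge → Set
IsClique 𝒫 M = ∀ a b → a ≢ b → ∃ λ Q → 𝒫 Q × HasPattern (lookup M a) (lookup M b) Q

blockStart : ℕ → List Block → ℕ → ℕ
blockStart k bs i = k * sum (map lam (take i bs))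

InV : ℕ → (bs : List Block) → Fin (length bs) → ℕ → Set
InV k bs i v = (blockStart k bs (toℕ i) ≤ v) × (v < blockStart k bs (toℕ i) + k * lam (lookup bs i))

InU : ℕ → (bs : List Block) {t : ℕ} → (Fin (length bs) → Fin (suc t)) → Fin (suc t) → ℕ → Set
InU k bs π j v = ∃ λ i → (π i ≡ j) × InV k bs i v

IsCliqueOn : ℕ → Word → ℕ → (ℕ → Set) → List Edge → Set
IsCliqueOn k Q m U K =
    (length K ≡ k)
  × IsMatching K
  × All (λ e → length e ≡ m) K
  × (∀ a v → v ∈ lookup K a → U v)
  × (∀ v → U v → ∃ λ a → v ∈ lookup K a)
  × IsClique (λ Q' → Q' ≡ Q) K

-- h is an edge of H_k(P,π) built from the cliques K_j: h = e_0 ∪ … ∪ e_t, e_j ∈ K_j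
IsHEdge : {t : ℕ} → (Fin (suc t) → List Edge) → Edge → Set
IsHEdge {t} K h =
  Linked _<_ h ×
  (∃ λ (c : (j : Fin (suc t)) → Fin (length (K j))) →
     ∀ v → ((v ∈ h → ∃ λ j → v ∈ lookup (K j) (c j))
           × (∀ j → v ∈ lookup (K j) (c j) → v ∈ h)))

-- Ordered ℓ-blow-up: vertex u is replaced by W_u = {uℓ, …, uℓ+ℓ-1}.

InW : ℕ → ℕ → ℕ → Set
InW ℓ u w = (u * ℓ ≤ w) × (w < u * ℓ + ℓ)

-- g is an edge of the blow-up: exactly one vertex in each W_u for u in some H-edge h
-- (the i-th smallest vertex of g lies in W of the i-th smallest vertex of h)
IsBlowEdge : {t : ℕ} → ℕ → (Fin (suc t) → List Edge) → Edge → Set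
IsBlowEdge ℓ K g = ∃ λ h → IsHEdge K h × Pointwise (InW ℓ) h g

IsScattered : ℕ → List Edge → Set
IsScattered ℓ M = ∀ a b x y u → x ∈ lookup M a → y ∈ lookup M b
                  → InW ℓ u x → InW ℓ u y → x ≡ y

module Submission where

-- Let K_j be a P_j-clique of size k on U_j and compare the words of two of its edges with P_j block by
-- block along V_1, V_2, …. On the first block one of the two readings is a prefix of the other, so an
-- edge with more than λ_i vertices in V_i would force every other edge to have at least λ_i vertices
-- there; as the k edges partition V_i and |V_i| = kλ_i, every edge has exactly λ_i vertices in V_i and
-- any two edges read exactly S_i or its mirror image on it. An edge of H_k(P,π) is the union of one edge
-- from each K_j, and two disjoint ones use different edges of every K_j (each meets V_i for i ∈ T_j);
-- so on each V_i they read S_i, flipped according to the orientation of their K_π(i)-components, which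
-- makes their pattern some P_F up to A ↔ B. Finally two edges of a scattered matching never meet a
-- common W_u, so the blow-up preserves the relative order of their vertices.

open import Defs
open import Data.Nat using (ℕ; zero; suc; _+_; _*_; _≤_; _<_; _<ᵇ_; z≤n; s≤s; z<s)
open import Data.Nat.Properties
open import Data.Fin using (Fin; toℕ; zero; suc; punchIn) renaming (_≟_ to _≟ᶠ_)
open import Data.Fin.Properties using (punchInᵢ≢i; toℕ-injective)
open import Data.List using (List; []; _∷_; _++_; map; concat; length; tabulate; allFin; concatMap; replicate; take; lookup)
open import Data.Nat.ListAction using (sum)
open import Data.List.Properties using (tabulate-cong; map-tabulate; concat-map; ∷-injective; map-∘; map-replicate; length-replicate)
open import Data.List.Membership.Propositional using (_∈_; _∉_)
open import Data.List.Membership.DecPropositional _≟_ using (_∈?_)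
open import Data.List.Relation.Unary.Any using (here; there)
open import Data.List.Relation.Unary.All using (All) renaming (lookup to lookupAll)
open import Data.List.Relation.Unary.Linked using (Linked; []; [-]; _∷_; tail)
open import Data.List.Relation.Unary.Linked.Properties using (Linked⇒AllPairs)
open import Data.List.Relation.Unary.AllPairs using (_∷_)
open import Data.List.Relation.Binary.Pointwise using (Pointwise; []; _∷_)
open import Data.List.Relation.Binary.Subset.Propositional using (_⊆_)
open import Data.List.Relation.Binary.Subset.Propositional.Properties using (⊆[]⇒≡[])
open import Data.List.Membership.Propositional.Properties using (∈-concat⁺′; ∈-tabulate⁺; ∈-lookup)
open import Data.Product using (∃; _×_; _,_; proj₁; proj₂)
open import Data.Sum using (_⊎_; inj₁; inj₂) renaming (map to map⊎)
open import Data.Bool using (Bool; true; false; not; if_then_else_)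
open import Data.Empty using (⊥; ⊥-elim)
open import Function using (_∘_; id; _⇔_; Equivalence; mk⇔)
open import Function.Construct.Identity using (⇔-id)
open import Relation.Binary.PropositionalEquality
open import Relation.Binary.Definitions using (Tri; tri<; tri≈; tri>)
open import Relation.Nullary using (yes; no)
open import Relation.Nullary.Decidable using (⌊_⌋)
import Algebra.Properties.CommutativeMonoid.Sum as Summation
open Summation +-0-commutativeMonoid using (sum-syntax; sum-remove; sum-cong-≗; sum-replicate-zero; ∑-distrib-+)

private variable
  X Y : Set
  n : ℕ

concatᶠ : (Fin n → List X) → List X
concatᶠ f = concat (tabulate f)

concatMap-allFin : (f : Fin n → List X) → concatMap f (allFin n) ≡ concatᶠ f
concatMap-allFin f = cong concat (map-tabulate id f)

concatᶠ-cong : {f g : Fin n → List X} → (∀ i → f i ≡ g i) → concatᶠ f ≡ concatᶠ g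
concatᶠ-cong f≗g = cong concat (tabulate-cong f≗g)

map-concatᶠ : (h : X → Y) (f : Fin n → List X) → map h (concatᶠ f) ≡ concatᶠ (map h ∘ f)
map-concatᶠ h f = trans (sym (concat-map (tabulate f))) (cong concat (map-tabulate f (map h)))

∈-concatᶠ : {f : Fin n → List X} {x : X} (i : Fin n) → x ∈ f i → x ∈ concatᶠ f
∈-concatᶠ {f = f} i x∈fi = ∈-concat⁺′ x∈fi (∈-tabulate⁺ {f = f} i)

∑-const : ∀ n c → ∑[ _ < n ] c ≡ n * c
∑-const zero    c = refl
∑-const (suc n) c = cong (c +_) (∑-const n c)

∑-mono-≤ : {f g : Fin n → ℕ} → (∀ i → f i ≤ g i) → ∑[ i < n ] f i ≤ ∑[ i < n ] g i
∑-mono-≤ {zero}  f≤g = z≤n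
∑-mono-≤ {suc n} f≤g = +-mono-≤ (f≤g zero) (∑-mono-≤ (f≤g ∘ suc))

∑-mono-< : {f g : Fin n → ℕ} → (∀ i → f i ≤ g i) → (i : Fin n) → f i < g i
         → ∑[ i < n ] f i < ∑[ i < n ] g i
∑-mono-< f≤g zero    fi<gi = +-mono-<-≤ fi<gi (∑-mono-≤ (f≤g ∘ suc))
∑-mono-< f≤g (suc i) fi<gi = +-mono-≤-< (f≤g zero) (∑-mono-< (f≤g ∘ suc) i fi<gi)

∑-indicator : (f : Fin n → ℕ) (i : Fin n) → f i ≡ 1 → (∀ j → j ≢ i → f j ≡ 0) → ∑[ j < n ] f j ≡ 1
∑-indicator {suc n} f i fi≡1 rest≡0 = begin
  ∑[ j < suc n ] f j                       ≡⟨ sum-remove {i = i} f ⟩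
  f i + ∑[ j < n ] f (punchIn i j)         ≡⟨ cong₂ _+_ fi≡1 (sum-cong-≗ (λ j → rest≡0 _ (punchInᵢ≢i i j))) ⟩
  1 + ∑[ j < n ] 0                         ≡⟨ cong (1 +_) (sum-replicate-zero n) ⟩
  1                                        ∎
  where open ≡-Reasoning

countB : Word → ℕ
countB []      = 0
countB (A ∷ w) = countB w
countB (B ∷ w) = suc (countB w)

countA-++ : ∀ u v → countA (u ++ v) ≡ countA u + countA v
countA-++ []      v = refl
countA-++ (A ∷ u) v = cong suc (countA-++ u v)
countA-++ (B ∷ u) v = countA-++ u v

countB-++ : ∀ u v → countB (u ++ v) ≡ countB u + countB v
countB-++ []      v = refl
countB-++ (A ∷ u) v = countB-++ u v
countB-++ (B ∷ u) v = cong suc (countB-++ u v)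

length≡countA+countB : ∀ w → length w ≡ countA w + countB w
length≡countA+countB []      = refl
length≡countA+countB (A ∷ w) = cong suc (length≡countA+countB w)
length≡countA+countB (B ∷ w) = trans (cong suc (length≡countA+countB w)) (sym (+-suc (countA w) (countB w)))

countA-swap : ∀ w → countA (map swapL w) ≡ countB w
countA-swap []      = refl
countA-swap (A ∷ w) = countA-swap w
countA-swap (B ∷ w) = cong suc (countA-swap w)

countB-swap : ∀ w → countB (map swapL w) ≡ countA w
countB-swap []      = refl
countB-swap (A ∷ w) = cong suc (countB-swap w)
countB-swap (B ∷ w) = countB-swap w

swap-involutive : ∀ w → map swapL (map swapL w) ≡ w
swap-involutive []      = refl
swap-involutive (A ∷ w) = cong (A ∷_) (swap-involutive w)
swap-involutive (B ∷ w) = cong (B ∷_) (swap-involutive w)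

swap-flipIf : ∀ σ w → map swapL (flipIf σ w) ≡ flipIf (not σ) w
swap-flipIf true  w = swap-involutive w
swap-flipIf false w = refl

flipIf-concatᶠ : ∀ σ (f : Fin n → Word) → flipIf σ (concatᶠ f) ≡ concatᶠ (flipIf σ ∘ f)
flipIf-concatᶠ true  f = map-concatᶠ swapL f
flipIf-concatᶠ false f = refl

Balanced : Word → Set
Balanced w = countA w ≡ countB w

flipIf-countA : ∀ σ {w} → Balanced w → countA (flipIf σ w) ≡ countA w
flipIf-countA true  {w} bal = trans (countA-swap w) (sym bal)
flipIf-countA false     bal = refl

flipIf-countB : ∀ σ {w} → Balanced w → countB (flipIf σ w) ≡ countA w
flipIf-countB true  {w} bal = countB-swap w
flipIf-countB false     bal = sym bal

countA-blockWord : ∀ b → countA (blockWord b) ≡ lam b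
countA-blockWord (x , t) = begin
  countA (replicate t x ++ replicate t (swapL x))           ≡⟨ cong (λ v → countA (replicate t x ++ v)) (map-replicate swapL t x) ⟨
  countA (replicate t x ++ map swapL (replicate t x))       ≡⟨ countA-++ (replicate t x) _ ⟩
  countA (replicate t x) + countA (map swapL (replicate t x)) ≡⟨ cong (countA (replicate t x) +_) (countA-swap (replicate t x)) ⟩
  countA (replicate t x) + countB (replicate t x)           ≡⟨ length≡countA+countB (replicate t x) ⟨
  length (replicate t x)                                    ≡⟨ length-replicate t ⟩
  t                                                         ∎
  where open ≡-Reasoning

countB-blockWord : ∀ b → countB (blockWord b) ≡ lam b
countB-blockWord (x , t) = begin
  countB (replicate t x ++ replicate t (swapL x))           ≡⟨ cong (λ v → countB (replicate t x ++ v)) (map-replicate swapL t x) ⟨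
  countB (replicate t x ++ map swapL (replicate t x))       ≡⟨ countB-++ (replicate t x) _ ⟩
  countB (replicate t x) + countB (map swapL (replicate t x)) ≡⟨ cong (countB (replicate t x) +_) (countB-swap (replicate t x)) ⟩
  countB (replicate t x) + countA (replicate t x)           ≡⟨ +-comm (countB (replicate t x)) _ ⟩
  countA (replicate t x) + countB (replicate t x)           ≡⟨ length≡countA+countB (replicate t x) ⟨
  length (replicate t x)                                    ≡⟨ length-replicate t ⟩
  t                                                         ∎
  where open ≡-Reasoning

++-comparable : (w r s r′ : List X) → w ++ r ≡ s ++ r′
              → (∃ λ u → s ≡ w ++ u) ⊎ (∃ λ u → w ≡ s ++ u)
++-comparable []      r s       r′ eq = inj₁ (s , refl)
++-comparable (x ∷ w) r []      r′ eq = inj₂ (x ∷ w , refl)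
++-comparable (x ∷ w) r (y ∷ s) r′ eq with ∷-injective eq
... | refl , eq′ with ++-comparable w r s r′ eq′
...   | inj₁ (u , s≡wu) = inj₁ (u , cong (x ∷_) s≡wu)
...   | inj₂ (u , w≡su) = inj₂ (u , cong (x ∷_) w≡su)

++-cancel-equal-length : (w r s r′ : List X) → w ++ r ≡ s ++ r′ → length w ≡ length s → w ≡ s × r ≡ r′
++-cancel-equal-length []      r []      r′ eq _   = refl , eq
++-cancel-equal-length (x ∷ w) r (y ∷ s) r′ eq len with ∷-injective eq
... | refl , eq′ with ++-cancel-equal-length w r s r′ eq′ (suc-injective len)
...   | w≡s , r≡r′ = cong (x ∷_) w≡s , r≡r′

first-block-reading : ∀ {k} (W R : Fin k → Fin k → Word) (x : Fin k → ℕ) (s : Word)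
  (σ : ∀ a b → a ≢ b → Bool) (R′ : ∀ a b → a ≢ b → Word)
  → (∀ a b → a ≢ b → countA (W a b) ≡ x a × countB (W a b) ≡ x b)
  → Balanced s
  → ∑[ a < k ] x a ≡ k * countA s
  → (∀ a b (ab : a ≢ b) → W a b ++ R a b ≡ flipIf (σ a b ab) s ++ R′ a b ab)
  → (∀ a → x a ≡ countA s) × (∀ a b (ab : a ≢ b) → W a b ≡ flipIf (σ a b ab) s × R a b ≡ R′ a b ab)
first-block-reading {k} W R x s σ R′ counts bal total reads = average , cancel
  where
  c : ℕ
  c = countA s

  -- An edge above the average c forces, through the prefix relation, every other edge to reach c.
  other-reaches : ∀ a b → a ≢ b → c < x a → c ≤ x b
  other-reaches a b ab c<xa with ++-comparable (W a b) (R a b) (flipIf (σ a b ab) s) _ (reads a b ab)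
  ... | inj₁ (u , s′≡Wu) = ⊥-elim (<⇒≱ c<xa (begin
          x a                             ≡⟨ proj₁ (counts a b ab) ⟨
          countA (W a b)                  ≤⟨ m≤m+n _ _ ⟩
          countA (W a b) + countA u       ≡⟨ countA-++ (W a b) u ⟨
          countA (W a b ++ u)             ≡⟨ cong countA s′≡Wu ⟨
          countA (flipIf (σ a b ab) s)    ≡⟨ flipIf-countA (σ a b ab) bal ⟩
          c                               ∎))
    where open ≤-Reasoning
  ... | inj₂ (u , W≡s′u) = begin
          c                                         ≡⟨ flipIf-countB (σ a b ab) bal ⟨
          countB (flipIf (σ a b ab) s)              ≤⟨ m≤m+n _ _ ⟩
          countB (flipIf (σ a b ab) s) + countB u   ≡⟨ countB-++ (flipIf (σ a b ab) s) u ⟨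
          countB (flipIf (σ a b ab) s ++ u)         ≡⟨ cong countB W≡s′u ⟨
          countB (W a b)                            ≡⟨ proj₂ (counts a b ab) ⟩
          x b                                       ∎
    where open ≤-Reasoning

  others-reach : ∀ a → c < x a → ∀ b → c ≤ x b
  others-reach a c<xa b with b ≟ᶠ a
  ... | yes refl = <⇒≤ c<xa
  ... | no b≢a   = other-reaches a b (b≢a ∘ sym) c<xa

  ∑const≡∑x : ∑[ _ < k ] c ≡ ∑[ a < k ] x a
  ∑const≡∑x = trans (∑-const k c) (sym total)

  at-most-average : ∀ a → x a ≤ c
  at-most-average a = ≮⇒≥ λ c<xa → <-irrefl ∑const≡∑x (∑-mono-< (others-reach a c<xa) a c<xa)

  average : ∀ a → x a ≡ c
  average a = ≤-antisym (at-most-average a)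
    (≮⇒≥ λ xa<c → <-irrefl (sym ∑const≡∑x) (∑-mono-< at-most-average a xa<c))

  cancel : ∀ a b (ab : a ≢ b) → W a b ≡ flipIf (σ a b ab) s × R a b ≡ R′ a b ab
  cancel a b ab = ++-cancel-equal-length (W a b) (R a b) (flipIf (σ a b ab) s) (R′ a b ab) (reads a b ab) (begin
    length (W a b)                                                   ≡⟨ length≡countA+countB (W a b) ⟩
    countA (W a b) + countB (W a b)                                  ≡⟨ cong₂ _+_ (proj₁ (counts a b ab)) (proj₂ (counts a b ab)) ⟩
    x a + x b                                                        ≡⟨ cong₂ _+_ (average a) (average b) ⟩
    c + c                                                            ≡⟨ cong₂ _+_ (flipIf-countA (σ a b ab) bal) (flipIf-countB (σ a b ab) bal) ⟨
    countA (flipIf (σ a b ab) s) + countB (flipIf (σ a b ab) s)      ≡⟨ length≡countA+countB (flipIf (σ a b ab) s) ⟨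
    length (flipIf (σ a b ab) s)                                     ∎)
    where open ≡-Reasoning

-- W a b i stands for the trace of the edges a, b of a clique on the vertex block V_i, x a i the number
-- of vertices of a in V_i, and S i the contribution of V_i to the common pattern.
blockwise-reading : ∀ {k} n (W : Fin k → Fin k → Fin n → Word) (x : Fin k → Fin n → ℕ)
  (S : Fin n → Word) (σ : ∀ a b → a ≢ b → Bool)
  → (∀ a b → a ≢ b → ∀ i → countA (W a b i) ≡ x a i × countB (W a b i) ≡ x b i)
  → (∀ i → Balanced (S i))
  → (∀ i → ∑[ a < k ] x a i ≡ k * countA (S i))
  → (∀ a b (ab : a ≢ b) → concatᶠ (W a b) ≡ concatᶠ (flipIf (σ a b ab) ∘ S))
  → (∀ a i → x a i ≡ countA (S i)) × (∀ a b (ab : a ≢ b) i → W a b i ≡ flipIf (σ a b ab) (S i))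
blockwise-reading zero    W x S σ counts bal total reads = (λ _ ()) , (λ _ _ _ ())
blockwise-reading (suc n) W x S σ counts bal total reads
  with first-block-reading (λ a b → W a b zero) (λ a b → concatᶠ (W a b ∘ suc)) (λ a → x a zero) (S zero) σ
         (λ a b ab → concatᶠ (flipIf (σ a b ab) ∘ S ∘ suc)) (λ a b ab → counts a b ab zero) (bal zero) (total zero) reads
... | average₀ , agree₀
  with blockwise-reading n (λ a b → W a b ∘ suc) (λ a → x a ∘ suc) (S ∘ suc) σ
         (λ a b ab → counts a b ab ∘ suc) (bal ∘ suc) (total ∘ suc) (λ a b ab → proj₂ (agree₀ a b ab))
... | average₊ , agree₊ = average , agree
  where
  average : ∀ a i → x a i ≡ countA (S i)
  average a zero    = average₀ a
  average a (suc i) = average₊ a i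

  agree : ∀ a b (ab : a ≢ b) i → W a b i ≡ flipIf (σ a b ab) (S i)
  agree a b ab zero    = proj₁ (agree₀ a b ab)
  agree a b ab (suc i) = agree₊ a b ab i

Sorted : List ℕ → Set
Sorted = Linked _<_

sorted-head< : ∀ {v vs u} → Sorted (v ∷ vs) → u ∈ vs → v < u
sorted-head< sorted u∈vs with Linked⇒AllPairs <-trans sorted
... | v<vs ∷ _ = lookupAll v<vs u∈vs

sorted-head-≤ : ∀ {v vs u} → Sorted (v ∷ vs) → u ∈ v ∷ vs → v ≤ u
sorted-head-≤ sorted (here refl)  = ≤-refl
sorted-head-≤ sorted (there u∈vs) = <⇒≤ (sorted-head< sorted u∈vs)

sorted-head-∉ : ∀ {v vs} → Sorted (v ∷ vs) → v ∉ vs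
sorted-head-∉ sorted v∈vs = <-irrefl refl (sorted-head< sorted v∈vs)

sorted-head-above : ∀ {v vs e} → Sorted (v ∷ vs) → e ⊆ v ∷ vs → v ∉ e → ∀ {u} → u ∈ e → v < u
sorted-head-above sorted e⊆ v∉e u∈e with e⊆ u∈e
... | here refl    = ⊥-elim (v∉e u∈e)
... | there u∈vs   = sorted-head< sorted u∈vs

⊆-∷⁻ : ∀ {v : ℕ} {vs e} → e ⊆ v ∷ vs → v ∉ e → e ⊆ vs
⊆-∷⁻ e⊆ v∉e u∈e with e⊆ u∈e
... | here refl  = ⊥-elim (v∉e u∈e)
... | there u∈vs = u∈vs

least-member-is-head : ∀ {v e} → Sorted e → (∀ {u} → u ∈ e → v ≤ u) → v ∈ e → ∃ λ e′ → e ≡ v ∷ e′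
least-member-is-head sorted v≤ (here refl)  = _ , refl
least-member-is-head sorted v≤ (there v∈e) = ⊥-elim (<⇒≱ (sorted-head< sorted v∈e) (v≤ (here refl)))

∈-∷-⇔ : ∀ {w v e} → v < w → (w ∈ e ⇔ w ∈ v ∷ e)
∈-∷-⇔ v<w = mk⇔ there λ { (here refl) → ⊥-elim (<-irrefl refl v<w) ; (there w∈e) → w∈e }

interval : ℕ → ℕ → List ℕ
interval m zero    = []
interval m (suc n) = m ∷ interval (suc m) n

∈-interval⁻ : ∀ m n {v} → v ∈ interval m n → m ≤ v × v < m + n
∈-interval⁻ m (suc n) (here refl) = ≤-refl , m<m+n m z<s
∈-interval⁻ m (suc n) {v} (there v∈) with ∈-interval⁻ (suc m) n v∈
... | m<v , v<m+1+n = <⇒≤ m<v , subst (v <_) (sym (+-suc m n)) v<m+1+n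

∈-interval⁺ : ∀ m n {v} → m ≤ v → v < m + n → v ∈ interval m n
∈-interval⁺ m zero    m≤v v<m+0 = ⊥-elim (<⇒≱ v<m+0 (subst (_≤ _) (sym (+-identityʳ m)) m≤v))
∈-interval⁺ m (suc n) {v} m≤v v<m+1+n with m ≟ v
... | yes refl = here refl
... | no m≢v   = there (∈-interval⁺ (suc m) n (≤∧≢⇒< m≤v m≢v) (subst (v <_) (+-suc m n) v<m+1+n))

interval-++ : ∀ m a b → interval m (a + b) ≡ interval m a ++ interval (m + a) b
interval-++ m zero    b = cong (λ m′ → interval m′ b) (sym (+-identityʳ m))
interval-++ m (suc a) b = cong (m ∷_) (trans (interval-++ (suc m) a b) (cong (λ m′ → interval (suc m) a ++ interval m′ b) (sym (+-suc m a))))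

interval-sorted : ∀ m n → Sorted (interval m n)
interval-sorted m zero          = []
interval-sorted m (suc zero)    = [-]
interval-sorted m (suc (suc n)) = ≤-refl ∷ interval-sorted (suc m) (suc n)

length-interval : ∀ m n → length (interval m n) ≡ n
length-interval m zero    = refl
length-interval m (suc n) = cong suc (length-interval (suc m) n)

<ᵇ-true : ∀ {m n} → m < n → (m <ᵇ n) ≡ true
<ᵇ-true {m} {n} m<n with m <ᵇ n | <⇒<ᵇ {m} {n} m<n
... | true | _ = refl

<ᵇ-false : ∀ {m n} → n ≤ m → (m <ᵇ n) ≡ false
<ᵇ-false {m} {n} n≤m with m <ᵇ n | <ᵇ⇒< m n
... | false | _   = refl
... | true  | m<n = ⊥-elim (<⇒≱ (m<n _) n≤m)

pairWord-[]ʳ : ∀ e → pairWord e [] ≡ map (λ _ → A) e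
pairWord-[]ʳ []      = refl
pairWord-[]ʳ (_ ∷ _) = refl

pairWord-< : ∀ {x y} xs ys → x < y → pairWord (x ∷ xs) (y ∷ ys) ≡ A ∷ pairWord xs (y ∷ ys)
pairWord-< xs ys x<y rewrite <ᵇ-true x<y = refl

pairWord-≥ : ∀ {x y} xs ys → y ≤ x → pairWord (x ∷ xs) (y ∷ ys) ≡ B ∷ pairWord (x ∷ xs) ys
pairWord-≥ xs ys y≤x rewrite <ᵇ-false y≤x = refl

pairWord-swap : ∀ e f → Disjoint e f → pairWord f e ≡ map swapL (pairWord e f)
pairWord-swap []       []       _   = refl
pairWord-swap []       (y ∷ ys) _   = map-∘ {g = swapL} {f = λ _ → B} (y ∷ ys)
pairWord-swap (x ∷ xs) []       _   = map-∘ {g = swapL} {f = λ _ → A} (x ∷ xs)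
pairWord-swap (x ∷ xs) (y ∷ ys) e#f =
  by-order (<-cmp x y) (pairWord-swap xs (y ∷ ys) (λ v → e#f v ∘ there))
                       (pairWord-swap (x ∷ xs) ys (λ v v∈e → e#f v v∈e ∘ there))
  where
  open ≡-Reasoning
  by-order : Tri (x < y) (x ≡ y) (y < x)
           → pairWord (y ∷ ys) xs ≡ map swapL (pairWord xs (y ∷ ys))
           → pairWord ys (x ∷ xs) ≡ map swapL (pairWord (x ∷ xs) ys)
           → pairWord (y ∷ ys) (x ∷ xs) ≡ map swapL (pairWord (x ∷ xs) (y ∷ ys))
  by-order (tri< x<y _ _) swapˡ _ = begin
    pairWord (y ∷ ys) (x ∷ xs)             ≡⟨ pairWord-≥ ys xs (<⇒≤ x<y) ⟩
    B ∷ pairWord (y ∷ ys) xs               ≡⟨ cong (B ∷_) swapˡ ⟩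
    B ∷ map swapL (pairWord xs (y ∷ ys))   ≡⟨ cong (map swapL) (pairWord-< xs ys x<y) ⟨
    map swapL (pairWord (x ∷ xs) (y ∷ ys)) ∎
  by-order (tri≈ _ refl _) _ _ = ⊥-elim (e#f x (here refl) (here refl))
  by-order (tri> _ _ y<x) _ swapʳ = begin
    pairWord (y ∷ ys) (x ∷ xs)             ≡⟨ pairWord-< ys xs y<x ⟩
    A ∷ pairWord ys (x ∷ xs)               ≡⟨ cong (A ∷_) swapʳ ⟩
    A ∷ map swapL (pairWord (x ∷ xs) ys)   ≡⟨ cong (map swapL) (pairWord-≥ xs ys (<⇒≤ y<x)) ⟨
    map swapL (pairWord (x ∷ xs) (y ∷ ys)) ∎

pairWord-∷ˡ : ∀ {v} e f → (∀ {u} → u ∈ f → v < u) → pairWord (v ∷ e) f ≡ A ∷ pairWord e f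
pairWord-∷ˡ e []      _   = cong (A ∷_) (sym (pairWord-[]ʳ e))
pairWord-∷ˡ e (y ∷ f) v<f = pairWord-< e f (v<f (here refl))

pairWord-∷ʳ : ∀ {v} e f → (∀ {u} → u ∈ e → v < u) → pairWord e (v ∷ f) ≡ B ∷ pairWord e f
pairWord-∷ʳ []      f _   = refl
pairWord-∷ʳ (x ∷ e) f v<e = pairWord-≥ e f (<⇒≤ (v<e (here refl)))

HasPattern⇒flipIf : ∀ {e f Q} → Disjoint e f → HasPattern e f Q → ∃ λ σ → pairWord e f ≡ flipIf σ Q
HasPattern⇒flipIf e#f (inj₁ ef≡Q) = false , ef≡Q
HasPattern⇒flipIf {e} {f} e#f (inj₂ fe≡Q) =
  true , trans (pairWord-swap f e (λ v v∈f v∈e → e#f v v∈e v∈f)) (cong (map swapL) fe≡Q)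

pattern-by-orientation : ∀ {e f Q} → Disjoint e f → (pairWord e f ≡ Q ⊎ map swapL (pairWord e f) ≡ Q) → HasPattern e f Q
pattern-by-orientation e#f (inj₁ ef≡Q)  = inj₁ ef≡Q
pattern-by-orientation {e} {f} e#f (inj₂ ef′≡Q) = inj₂ (trans (pairWord-swap e f e#f) ef′≡Q)

trace : Edge → Edge → List ℕ → Word
trace e f [] = []
trace e f (v ∷ vs) with v ∈? e | v ∈? f
... | yes _ | _     = A ∷ trace e f vs
... | no _  | yes _ = B ∷ trace e f vs
... | no _  | no _  = trace e f vs

hits : Edge → List ℕ → ℕ
hits e [] = 0
hits e (v ∷ vs) with v ∈? e
... | yes _ = suc (hits e vs)
... | no _  = hits e vs

trace-++ : ∀ e f xs ys → trace e f (xs ++ ys) ≡ trace e f xs ++ trace e f ys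
trace-++ e f []       ys = refl
trace-++ e f (v ∷ xs) ys with v ∈? e | v ∈? f
... | yes _ | _     = cong (A ∷_) (trace-++ e f xs ys)
... | no _  | yes _ = cong (B ∷_) (trace-++ e f xs ys)
... | no _  | no _  = trace-++ e f xs ys

trace-concatᶠ : ∀ e f (g : Fin n → List ℕ) → trace e f (concatᶠ g) ≡ concatᶠ (trace e f ∘ g)
trace-concatᶠ {zero}  e f g = refl
trace-concatᶠ {suc n} e f g =
  trans (trace-++ e f (g zero) _) (cong (trace e f (g zero) ++_) (trace-concatᶠ e f (g ∘ suc)))

countA-trace : ∀ e f vs → countA (trace e f vs) ≡ hits e vs
countA-trace e f [] = refl
countA-trace e f (v ∷ vs) with v ∈? e | v ∈? f
... | yes _ | _     = cong suc (countA-trace e f vs)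
... | no _  | yes _ = countA-trace e f vs
... | no _  | no _  = countA-trace e f vs

countB-trace : ∀ e f vs → Disjoint e f → countB (trace e f vs) ≡ hits f vs
countB-trace e f [] _ = refl
countB-trace e f (v ∷ vs) e#f with v ∈? e | v ∈? f
... | yes v∈e | yes v∈f = ⊥-elim (e#f v v∈e v∈f)
... | yes _   | no _    = countB-trace e f vs e#f
... | no _    | yes _   = cong suc (countB-trace e f vs e#f)
... | no _    | no _    = countB-trace e f vs e#f

trace-cong : ∀ {e f e′ f′} vs → (∀ v → v ∈ vs → (v ∈ e ⇔ v ∈ e′) × (v ∈ f ⇔ v ∈ f′))
           → trace e f vs ≡ trace e′ f′ vs
trace-cong [] _ = refl
trace-cong {e} {f} {e′} {f′} (v ∷ vs) same with v ∈? e | v ∈? f | v ∈? e′ | v ∈? f′ | same v (here refl)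
... | yes _   | _       | yes _    | _        | _ = cong (A ∷_) (trace-cong vs (λ w → same w ∘ there))
... | yes v∈e | _       | no v∉e′  | _        | e⇔e′ , _ = ⊥-elim (v∉e′ (Equivalence.to e⇔e′ v∈e))
... | no v∉e  | _       | yes v∈e′ | _        | e⇔e′ , _ = ⊥-elim (v∉e (Equivalence.from e⇔e′ v∈e′))
... | no _    | yes _   | no _     | yes _    | _ = cong (B ∷_) (trace-cong vs (λ w → same w ∘ there))
... | no _    | yes v∈f | no _     | no v∉f′  | _ , f⇔f′ = ⊥-elim (v∉f′ (Equivalence.to f⇔f′ v∈f))
... | no _    | no v∉f  | no _     | yes v∈f′ | _ , f⇔f′ = ⊥-elim (v∉f (Equivalence.from f⇔f′ v∈f′))
... | no _    | no _    | no _     | no _     | _ = trace-cong vs (λ w → same w ∘ there)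

hits-outside : ∀ e vs → (∀ v → v ∈ vs → v ∉ e) → hits e vs ≡ 0
hits-outside e [] _ = refl
hits-outside e (v ∷ vs) out with v ∈? e
... | yes v∈e = ⊥-elim (out v (here refl) v∈e)
... | no _    = hits-outside e vs (λ w → out w ∘ there)

hits-++ : ∀ e xs ys → hits e (xs ++ ys) ≡ hits e xs + hits e ys
hits-++ e []       ys = refl
hits-++ e (v ∷ xs) ys with v ∈? e
... | yes _ = cong suc (hits-++ e xs ys)
... | no _  = hits-++ e xs ys

hits-[-] : ∀ {v e} → v ∈ e → hits e (v ∷ []) ≡ 1
hits-[-] {v} {e} v∈e with v ∈? e
... | yes _   = refl
... | no v∉e  = ⊥-elim (v∉e v∈e)

hits-pos : ∀ e vs → 1 ≤ hits e vs → ∃ λ v → v ∈ vs × v ∈ e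
hits-pos e (v ∷ vs) pos with v ∈? e
... | yes v∈e = v , here refl , v∈e
... | no _ with hits-pos e vs pos
...   | w , w∈vs , w∈e = w , there w∈vs , w∈e

hits-partition : (E : Fin n → Edge) (vs : List ℕ) → (∀ v → v ∈ vs → ∃ λ a → v ∈ E a)
               → (∀ a b → a ≢ b → Disjoint (E a) (E b)) → ∑[ a < n ] hits (E a) vs ≡ length vs
hits-partition {n} E []       _     _ = sum-replicate-zero n
hits-partition {n} E (v ∷ vs) cover E# with cover v (here refl)
... | a₀ , v∈Ea₀ = begin
  ∑[ a < n ] hits (E a) (v ∷ vs)                             ≡⟨ sum-cong-≗ (λ a → hits-++ (E a) (v ∷ []) vs) ⟩
  ∑[ a < n ] (hits (E a) (v ∷ []) + hits (E a) vs)           ≡⟨ ∑-distrib-+ (λ a → hits (E a) (v ∷ [])) (λ a → hits (E a) vs) ⟩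
  ∑[ a < n ] hits (E a) (v ∷ []) + ∑[ a < n ] hits (E a) vs  ≡⟨ cong₂ _+_ single (hits-partition E vs (λ w → cover w ∘ there) E#) ⟩
  suc (length vs)                                            ∎
  where
  open ≡-Reasoning
  single : ∑[ a < n ] hits (E a) (v ∷ []) ≡ 1
  single = ∑-indicator (λ a → hits (E a) (v ∷ [])) a₀ (hits-[-] v∈Ea₀)
             (λ b b≢a₀ → hits-outside (E b) (v ∷ []) λ { w (here refl) v∈Eb → E# b a₀ b≢a₀ v v∈Eb v∈Ea₀ })

pairWord-trace : ∀ {e f} vs → Sorted vs → Sorted e → Sorted f → Disjoint e f → e ⊆ vs → f ⊆ vs
               → pairWord e f ≡ trace e f vs
pairWord-trace [] _ _ _ _ e⊆ f⊆ with ⊆[]⇒≡[] e⊆ | ⊆[]⇒≡[] f⊆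
... | refl | refl = refl
pairWord-trace {e} {f} (v ∷ vs) sorted e↑ f↑ e#f e⊆ f⊆ with v ∈? e | v ∈? f
... | yes v∈e | _ with least-member-is-head e↑ (sorted-head-≤ sorted ∘ e⊆) v∈e
...   | e′ , refl = begin
  pairWord (v ∷ e′) f      ≡⟨ pairWord-∷ˡ e′ f (sorted-head-above sorted f⊆ v∉f) ⟩
  A ∷ pairWord e′ f        ≡⟨ cong (A ∷_) (pairWord-trace vs (tail sorted) (tail e↑) f↑ (λ u → e#f u ∘ there)
                                (⊆-∷⁻ (e⊆ ∘ there) (sorted-head-∉ e↑)) (⊆-∷⁻ f⊆ v∉f)) ⟩
  A ∷ trace e′ f vs        ≡⟨ cong (A ∷_) (trace-cong vs (λ w w∈vs → ∈-∷-⇔ (sorted-head< sorted w∈vs) , ⇔-id _)) ⟩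
  A ∷ trace (v ∷ e′) f vs  ∎
  where
  open ≡-Reasoning
  v∉f : v ∉ f
  v∉f = e#f v (here refl)
pairWord-trace {e} {f} (v ∷ vs) sorted e↑ f↑ e#f e⊆ f⊆ | no v∉e | yes v∈f
  with least-member-is-head f↑ (sorted-head-≤ sorted ∘ f⊆) v∈f
... | f′ , refl = begin
  pairWord e (v ∷ f′)      ≡⟨ pairWord-∷ʳ e f′ (sorted-head-above sorted e⊆ v∉e) ⟩
  B ∷ pairWord e f′        ≡⟨ cong (B ∷_) (pairWord-trace vs (tail sorted) e↑ (tail f↑) (λ u u∈e → e#f u u∈e ∘ there)
                                (⊆-∷⁻ e⊆ v∉e) (⊆-∷⁻ (f⊆ ∘ there) (sorted-head-∉ f↑))) ⟩
  B ∷ trace e f′ vs        ≡⟨ cong (B ∷_) (trace-cong vs (λ w w∈vs → ⇔-id _ , ∈-∷-⇔ (sorted-head< sorted w∈vs))) ⟩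
  B ∷ trace e (v ∷ f′) vs  ∎
  where open ≡-Reasoning
pairWord-trace {e} {f} (v ∷ vs) sorted e↑ f↑ e#f e⊆ f⊆ | no v∉e | no v∉f =
  pairWord-trace vs (tail sorted) e↑ f↑ e#f (⊆-∷⁻ e⊆ v∉e) (⊆-∷⁻ f⊆ v∉f)

Separated : ℕ → Edge → Edge → Set
Separated ℓ g g′ = ∀ u {x y} → x ∈ g → y ∈ g′ → InW ℓ u x → InW ℓ u y → ⊥

Separated-sym : ∀ {ℓ g g′} → Separated ℓ g g′ → Separated ℓ g′ g
Separated-sym sep u y∈g′ x∈g y∈Wu x∈Wu = sep u x∈g y∈g′ x∈Wu y∈Wu

InW-< : ∀ {ℓ u w x y} → InW ℓ u x → InW ℓ w y → u < w → x < y
InW-< {ℓ} {u} {w} {x} {y} (_ , x<uℓ+ℓ) (wℓ≤y , _) u<w = begin-strict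
  x          <⟨ x<uℓ+ℓ ⟩
  u * ℓ + ℓ  ≡⟨ +-comm (u * ℓ) ℓ ⟩
  suc u * ℓ  ≤⟨ *-monoˡ-≤ ℓ u<w ⟩
  w * ℓ      ≤⟨ wℓ≤y ⟩
  y          ∎
  where open ≤-Reasoning

map-const-Pointwise : ∀ {R : ℕ → ℕ → Set} {h g} (c : Letter) → Pointwise R h g → map (λ _ → c) g ≡ map (λ _ → c) h
map-const-Pointwise c []       = refl
map-const-Pointwise c (_ ∷ rs) = cong (c ∷_) (map-const-Pointwise c rs)

pairWord-blowUp : ∀ {ℓ h h′ g g′} → Pointwise (InW ℓ) h g → Pointwise (InW ℓ) h′ g′ → Separated ℓ g g′
                → pairWord g g′ ≡ pairWord h h′
pairWord-blowUp {ℓ} []             qs _ = map-const-Pointwise {InW ℓ} B qs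
pairWord-blowUp {ℓ} ps@(_ ∷ _)     [] _ = map-const-Pointwise {InW ℓ} A ps
pairWord-blowUp {ℓ} {u ∷ us} {w ∷ ws} {x ∷ xs} {y ∷ ys} (p ∷ ps) (q ∷ qs) sep =
  by-order (<-cmp u w) (pairWord-blowUp ps (q ∷ qs) (λ z → sep z ∘ there))
                       (pairWord-blowUp (p ∷ ps) qs (λ z x∈ → sep z x∈ ∘ there))
  where
  open ≡-Reasoning
  by-order : Tri (u < w) (u ≡ w) (w < u)
           → pairWord xs (y ∷ ys) ≡ pairWord us (w ∷ ws)
           → pairWord (x ∷ xs) ys ≡ pairWord (u ∷ us) ws
           → pairWord (x ∷ xs) (y ∷ ys) ≡ pairWord (u ∷ us) (w ∷ ws)
  by-order (tri< u<w _ _) blowˡ _ = begin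
    pairWord (x ∷ xs) (y ∷ ys)  ≡⟨ pairWord-< xs ys (InW-< {ℓ} {u} {w} p q u<w) ⟩
    A ∷ pairWord xs (y ∷ ys)    ≡⟨ cong (A ∷_) blowˡ ⟩
    A ∷ pairWord us (w ∷ ws)    ≡⟨ pairWord-< us ws u<w ⟨
    pairWord (u ∷ us) (w ∷ ws)  ∎
  by-order (tri≈ _ refl _) _ _ = ⊥-elim (sep u (here refl) (here refl) p q)
  by-order (tri> _ _ w<u) _ blowʳ = begin
    pairWord (x ∷ xs) (y ∷ ys)  ≡⟨ pairWord-≥ xs ys (<⇒≤ (InW-< {ℓ} {w} {u} q p w<u)) ⟩
    B ∷ pairWord (x ∷ xs) ys    ≡⟨ cong (B ∷_) blowʳ ⟩
    B ∷ pairWord (u ∷ us) ws    ≡⟨ pairWord-≥ us ws (<⇒≤ w<u) ⟨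
    pairWord (u ∷ us) (w ∷ ws)  ∎

Pointwise-∈ : ∀ {R : ℕ → ℕ → Set} {h g v} → Pointwise R h g → v ∈ h → ∃ λ x → x ∈ g × R v x
Pointwise-∈ (r ∷ _)  (here refl) = _ , here refl , r
Pointwise-∈ (_ ∷ rs) (there v∈h) with Pointwise-∈ rs v∈h
... | x , x∈g , r = x , there x∈g , r

scattered⇒separated : ∀ {ℓ M} → IsMatching M → IsScattered ℓ M → ∀ {a b} → a ≢ b → Separated ℓ (lookup M a) (lookup M b)
scattered⇒separated {M = M} (_ , disjoint) scattered {a} {b} a≢b u {x} {y} x∈Ma y∈Mb x∈Wu y∈Wu =
  disjoint a b a≢b x x∈Ma (subst (_∈ lookup M b) (sym (scattered a b x y u x∈Ma y∈Mb x∈Wu y∈Wu)) y∈Mb)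

separated⇒disjoint : ∀ {ℓ h h′ g g′} → Pointwise (InW ℓ) h g → Pointwise (InW ℓ) h′ g′ → Separated ℓ g g′ → Disjoint h h′
separated⇒disjoint {ℓ} h~g h′~g′ sep v v∈h v∈h′ with Pointwise-∈ {InW ℓ} h~g v∈h | Pointwise-∈ {InW ℓ} h′~g′ v∈h′
... | x , x∈g , x∈Wv | y , y∈g′ , y∈Wv = sep v x∈g y∈g′ x∈Wv y∈Wv

sum-map-take-suc : (f : X → ℕ) (xs : List X) (i : Fin (length xs))
  → sum (map f (take (suc (toℕ i)) xs)) ≡ sum (map f (take (toℕ i) xs)) + f (lookup xs i)
sum-map-take-suc f (x ∷ xs) zero    = +-comm (f x) 0
sum-map-take-suc f (x ∷ xs) (suc i) = trans (cong (f x +_) (sum-map-take-suc f xs i)) (sym (+-assoc (f x) _ _))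

sum-map-take-mono : (f : X → ℕ) (xs : List X) {m n : ℕ} → m ≤ n → sum (map f (take m xs)) ≤ sum (map f (take n xs))
sum-map-take-mono f xs       {zero}          _         = z≤n
sum-map-take-mono f []       {suc m} {suc n} _         = z≤n
sum-map-take-mono f (x ∷ xs) {suc m} {suc n} (s≤s m≤n) = +-monoʳ-≤ (f x) (sum-map-take-mono f xs m≤n)

concatᶠ-blocks : ∀ k bs m
  → concatᶠ (λ (i : Fin (length bs)) → interval (m + blockStart k bs (toℕ i)) (k * lam (lookup bs i)))
    ≡ interval m (k * sum (map lam bs))
concatᶠ-blocks k []       m = cong (interval m) (sym (*-zeroʳ k))
concatᶠ-blocks k (b ∷ bs) m = begin
  interval (m + k * 0) (k * lam b) ++
    concatᶠ (λ i → interval (m + k * (lam b + sum (map lam (take (toℕ i) bs)))) (k * lam (lookup bs i)))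
      ≡⟨ cong₂ _++_ (cong (λ m′ → interval m′ (k * lam b)) (trans (cong (m +_) (*-zeroʳ k)) (+-identityʳ m)))
                    (concatᶠ-cong λ i → cong (λ m′ → interval m′ (k * lam (lookup bs i))) (shift i)) ⟩
  interval m (k * lam b) ++ concatᶠ (λ i → interval (m + k * lam b + blockStart k bs (toℕ i)) (k * lam (lookup bs i)))
      ≡⟨ cong (interval m (k * lam b) ++_) (concatᶠ-blocks k bs (m + k * lam b)) ⟩
  interval m (k * lam b) ++ interval (m + k * lam b) (k * sum (map lam bs))
      ≡⟨ interval-++ m (k * lam b) _ ⟨
  interval m (k * lam b + k * sum (map lam bs))
      ≡⟨ cong (interval m) (*-distribˡ-+ k (lam b) _) ⟨
  interval m (k * (lam b + sum (map lam bs)))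
      ∎
  where
  open ≡-Reasoning
  shift : ∀ i → m + k * (lam b + sum (map lam (take (toℕ i) bs))) ≡ m + k * lam b + blockStart k bs (toℕ i)
  shift i = trans (cong (m +_) (*-distribˡ-+ k (lam b) _)) (sym (+-assoc m _ _))

module Blocks (k : ℕ) (bs : List Block) where

  V : Fin (length bs) → List ℕ
  V i = interval (blockStart k bs (toℕ i)) (k * lam (lookup bs i))

  allVertices : List ℕ
  allVertices = interval 0 (k * sum (map lam bs))

  blockStart-suc : ∀ i → blockStart k bs (suc (toℕ i)) ≡ blockStart k bs (toℕ i) + k * lam (lookup bs i)
  blockStart-suc i = trans (cong (k *_) (sum-map-take-suc lam bs i)) (*-distribˡ-+ k _ _)

  concatᶠ-V : concatᶠ V ≡ allVertices
  concatᶠ-V = concatᶠ-blocks k bs 0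

  V-before : ∀ {i i′ : Fin (length bs)} → toℕ i < toℕ i′ → blockStart k bs (toℕ i) + k * lam (lookup bs i) ≤ blockStart k bs (toℕ i′)
  V-before {i} {i′} i<i′ = subst (_≤ blockStart k bs (toℕ i′)) (blockStart-suc i) (*-monoʳ-≤ k (sum-map-take-mono lam bs i<i′))

  V-disjoint : ∀ {i i′ : Fin (length bs)} {v} → v ∈ V i → v ∈ V i′ → i ≡ i′
  V-disjoint {i} {i′} v∈Vi v∈Vi′ with <-cmp (toℕ i) (toℕ i′)
  ... | tri< i<i′ _ _ = ⊥-elim (<⇒≱ (proj₂ (∈-interval⁻ _ _ v∈Vi)) (≤-trans (V-before {i} {i′} i<i′) (proj₁ (∈-interval⁻ _ _ v∈Vi′))))
  ... | tri≈ _ i≡i′ _ = toℕ-injective i≡i′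
  ... | tri> _ _ i′<i = ⊥-elim (<⇒≱ (proj₂ (∈-interval⁻ _ _ v∈Vi′)) (≤-trans (V-before {i′} {i} i′<i) (proj₁ (∈-interval⁻ _ _ v∈Vi))))

  V-⊆-allVertices : ∀ i → V i ⊆ allVertices
  V-⊆-allVertices i v∈Vi = subst (_ ∈_) concatᶠ-V (∈-concatᶠ i v∈Vi)

  InV⇒∈V : ∀ {i v} → InV k bs i v → v ∈ V i
  InV⇒∈V (start≤v , v<end) = ∈-interval⁺ _ _ start≤v v<end

  ∈V⇒InV : ∀ {i v} → v ∈ V i → InV k bs i v
  ∈V⇒InV = ∈-interval⁻ _ _

  pairWord-blocks : ∀ {e f} → Sorted e → Sorted f → Disjoint e f → e ⊆ allVertices → f ⊆ allVertices
                  → pairWord e f ≡ concatᶠ (λ i → trace e f (V i))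
  pairWord-blocks {e} {f} e↑ f↑ e#f e⊆ f⊆ = begin
    pairWord e f                     ≡⟨ pairWord-trace allVertices (interval-sorted 0 _) e↑ f↑ e#f e⊆ f⊆ ⟩
    trace e f allVertices            ≡⟨ cong (trace e f) concatᶠ-V ⟨
    trace e f (concatᶠ V)            ≡⟨ trace-concatᶠ e f V ⟩
    concatᶠ (λ i → trace e f (V i))  ∎
    where open ≡-Reasoning

module MegaBlocks (k : ℕ) (bs : List Block) {t : ℕ} (π : Fin (length bs) → Fin (suc t)) where
  open Blocks k bs

  megaPiece : Fin (suc t) → Fin (length bs) → Word
  megaPiece j i = if ⌊ π i ≟ᶠ j ⌋ then blockWord (lookup bs i) else []

  megaPiece-balanced : ∀ j i → Balanced (megaPiece j i)
  megaPiece-balanced j i with π i ≟ᶠ j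
  ... | yes _ = trans (countA-blockWord (lookup bs i)) (sym (countB-blockWord (lookup bs i)))
  ... | no _  = refl

  megaPiece-own : ∀ i → megaPiece (π i) i ≡ blockWord (lookup bs i)
  megaPiece-own i with π i ≟ᶠ π i
  ... | yes _  = refl
  ... | no π≢π = ⊥-elim (π≢π refl)

  InU⇒block : ∀ {j i v} → InU k bs π j v → v ∈ V i → π i ≡ j
  InU⇒block {j} (i′ , πi′≡j , v∈Vi′) v∈Vi = subst (λ i → π i ≡ j) (V-disjoint (InV⇒∈V v∈Vi′) v∈Vi) πi′≡j

  IsMegaClique : Fin (suc t) → List Edge → Set
  IsMegaClique j = IsCliqueOn k (megaBlock bs π j) (rj bs π j) (InU k bs π j)

  clique-total : ∀ j {L} → IsMegaClique j L
    → ∀ i → ∑[ a < length L ] hits (lookup L a) (V i) ≡ length L * countA (megaPiece j i)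
  clique-total j {L} (|L|≡k , (_ , disjoint) , _ , inU , cover , _) i with π i ≟ᶠ j
  ... | yes πi≡j = begin
    ∑[ a < length L ] hits (lookup L a) (V i)    ≡⟨ hits-partition (lookup L) (V i) (λ v v∈Vi → cover v (i , πi≡j , ∈V⇒InV v∈Vi)) disjoint ⟩
    length (V i)                                ≡⟨ length-interval _ _ ⟩
    k * lam (lookup bs i)                       ≡⟨ cong₂ _*_ |L|≡k (countA-blockWord (lookup bs i)) ⟨
    length L * countA (blockWord (lookup bs i)) ∎
    where open ≡-Reasoning
  ... | no πi≢j = begin
    ∑[ a < length L ] hits (lookup L a) (V i)    ≡⟨ sum-cong-≗ (λ a → hits-outside (lookup L a) (V i) λ v v∈Vi v∈La →
                                                                  πi≢j (InU⇒block (inU a v v∈La) v∈Vi)) ⟩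
    ∑[ a < length L ] 0                         ≡⟨ sum-replicate-zero (length L) ⟩
    0                                           ≡⟨ *-zeroʳ (length L) ⟨
    length L * 0                                ∎
    where open ≡-Reasoning

  clique-orientation : ∀ j {L} → IsMegaClique j L → ∀ a b → a ≢ b
    → ∃ λ σ → concatᶠ (λ i → trace (lookup L a) (lookup L b) (V i)) ≡ concatᶠ (flipIf σ ∘ megaPiece j)
  clique-orientation j {L} (_ , (sorted , disjoint) , _ , inU , _ , clique) a b ab with clique a b ab
  ... | _ , refl , has with HasPattern⇒flipIf (disjoint a b ab) has
  ...   | σ , ab≡σPj = σ , (begin
    concatᶠ (λ i → trace (E a) (E b) (V i))  ≡⟨ pairWord-blocks (E-sorted a) (E-sorted b) (disjoint a b ab)
                                                   (E⊆allVertices a) (E⊆allVertices b) ⟨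
    pairWord (E a) (E b)                     ≡⟨ ab≡σPj ⟩
    flipIf σ (megaBlock bs π j)              ≡⟨ cong (flipIf σ) (concatMap-allFin (megaPiece j)) ⟩
    flipIf σ (concatᶠ (megaPiece j))         ≡⟨ flipIf-concatᶠ σ (megaPiece j) ⟩
    concatᶠ (flipIf σ ∘ megaPiece j)         ∎)
    where
    open ≡-Reasoning
    E : Fin (length L) → Edge
    E = lookup L

    E-sorted : ∀ a → Sorted (E a)
    E-sorted a = lookupAll sorted (∈-lookup a)

    E⊆allVertices : ∀ a → E a ⊆ allVertices
    E⊆allVertices a v∈Ea with inU a _ v∈Ea
    ... | i , _ , v∈Vi = V-⊆-allVertices i (InV⇒∈V v∈Vi)

  clique-reads-blocks : ∀ j {L} → IsMegaClique j L
    → (∀ a i → hits (lookup L a) (V i) ≡ countA (megaPiece j i))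
    × (∀ a b → a ≢ b → ∃ λ σ → ∀ i → trace (lookup L a) (lookup L b) (V i) ≡ flipIf σ (megaPiece j i))
  clique-reads-blocks j {L} isClique@(_ , (_ , disjoint) , _) with
    blockwise-reading (length bs) (λ a b i → trace (lookup L a) (lookup L b) (V i)) (λ a i → hits (lookup L a) (V i))
      (megaPiece j) (λ a b ab → proj₁ (clique-orientation j isClique a b ab))
      (λ a b ab i → countA-trace (lookup L a) (lookup L b) (V i) , countB-trace (lookup L a) (lookup L b) (V i) (disjoint a b ab))
      (megaPiece-balanced j) (clique-total j isClique) (λ a b ab → proj₂ (clique-orientation j isClique a b ab))
  ... | average , agree = average , λ a b ab → proj₁ (clique-orientation j isClique a b ab) , agree a b ab

  orientedBlock : (Fin (suc t) → Bool) → Fin (length bs) → Word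
  orientedBlock τ i = flipIf (τ (π i)) (blockWord (lookup bs i))

  orientedPattern : (Fin (suc t) → Bool) → Word
  orientedPattern τ = concatᶠ (orientedBlock τ)

  flipPattern≡orientedPattern : ∀ τ → τ zero ≡ false → flipPattern bs π (τ ∘ suc) ≡ orientedPattern τ
  flipPattern≡orientedPattern τ τ₀≡false =
    trans (concatMap-allFin (orientedBlock (isFlipped (τ ∘ suc)))) (concatᶠ-cong λ i → cong (λ σ → flipIf σ (blockWord (lookup bs i))) (flipped (π i)))
    where
    flipped : ∀ j → isFlipped (τ ∘ suc) j ≡ τ j
    flipped zero    = sym τ₀≡false
    flipped (suc j) = refl

  swap-orientedPattern : ∀ τ → map swapL (orientedPattern τ) ≡ orientedPattern (not ∘ τ)
  swap-orientedPattern τ =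
    trans (map-concatᶠ swapL (orientedBlock τ)) (concatᶠ-cong λ i → swap-flipIf (τ (π i)) (blockWord (lookup bs i)))

  -- Patterns are read up to A ↔ B, so the orientation of the mega-block P_0 can be normalised away.
  orientedPattern-∈C : ∀ τ → ∃ λ Q → CP bs π Q × (orientedPattern τ ≡ Q ⊎ map swapL (orientedPattern τ) ≡ Q)
  orientedPattern-∈C τ with τ zero in τ₀
  ... | false = orientedPattern τ , (τ ∘ suc , sym (flipPattern≡orientedPattern τ τ₀)) , inj₁ refl
  ... | true  = orientedPattern (not ∘ τ) , (not ∘ τ ∘ suc , sym (flipPattern≡orientedPattern (not ∘ τ) (cong not τ₀)))
              , inj₂ (swap-orientedPattern τ)

module HEdges (k : ℕ) (bs : List Block) {t : ℕ} (π : Fin (length bs) → Fin (suc t))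
  (surjective : ∀ j → ∃ λ i → π i ≡ j) (blocks-nonempty : All (λ b → 1 ≤ lam b) bs)
  (K : Fin (suc t) → List Edge)
  (cliques : ∀ j → IsCliqueOn k (megaBlock bs π j) (rj bs π j) (InU k bs π j) (K j)) where
  open Blocks k bs
  open MegaBlocks k bs π

  Choice : Set
  Choice = (j : Fin (suc t)) → Fin (length (K j))

  component : Choice → Fin (suc t) → Edge
  component c j = lookup (K j) (c j)

  Assembles : Choice → Edge → Set
  Assembles c h = ∀ v → (v ∈ h → ∃ λ j → v ∈ component c j) × (∀ j → v ∈ component c j → v ∈ h)

  component-InU : ∀ c j {v} → v ∈ component c j → InU k bs π j v
  component-InU c j with cliques j
  ... | _ , _ , _ , inU , _ = inU (c j) _

  assembled-on-block : ∀ {c h i v} → Assembles c h → v ∈ V i → (v ∈ h ⇔ v ∈ component c (π i))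
  assembled-on-block {c} {h} {i} {v} assembles v∈Vi = mk⇔ to (proj₂ (assembles v) (π i))
    where
    to : v ∈ h → v ∈ component c (π i)
    to v∈h with proj₁ (assembles v) v∈h
    ... | j , v∈cj with InU⇒block (component-InU c j v∈cj) v∈Vi
    ...   | refl = v∈cj

  assembled-⊆ : ∀ {c h} → Assembles c h → h ⊆ allVertices
  assembled-⊆ {c} assembles {v} v∈h with proj₁ (assembles v) v∈h
  ... | j , v∈cj with component-InU c j v∈cj
  ...   | i , _ , v∈Vi = V-⊆-allVertices i (InV⇒∈V v∈Vi)

  components-distinct : ∀ {c c′ h h′} → Assembles c h → Assembles c′ h′ → Disjoint h h′ → ∀ j → c j ≢ c′ j
  components-distinct {c} {c′} assembles assembles′ h#h′ j cj≡c′j with surjective j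
  ... | i , refl with hits-pos (component c (π i)) (V i) (subst (1 ≤_) (sym meets) (lookupAll blocks-nonempty (∈-lookup i)))
    where
    meets : hits (component c (π i)) (V i) ≡ lam (lookup bs i)
    meets = trans (proj₁ (clique-reads-blocks (π i) (cliques (π i))) (c (π i)) i)
                  (trans (cong countA (megaPiece-own i)) (countA-blockWord (lookup bs i)))
  ... | v , _ , v∈ci = h#h′ v (proj₂ (assembles v) (π i) v∈ci)
                              (proj₂ (assembles′ v) (π i) (subst (λ a → v ∈ lookup (K (π i)) a) cj≡c′j v∈ci))

  hEdges-oriented : ∀ {h h′} → IsHEdge K h → IsHEdge K h′ → Disjoint h h′
                  → ∃ λ τ → pairWord h h′ ≡ orientedPattern τ
  hEdges-oriented {h} {h′} (h↑ , c , assembles) (h′↑ , c′ , assembles′) h#h′ = τ , (begin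
    pairWord h h′                     ≡⟨ pairWord-blocks h↑ h′↑ h#h′ (assembled-⊆ assembles) (assembled-⊆ assembles′) ⟩
    concatᶠ (λ i → trace h h′ (V i))  ≡⟨ concatᶠ-cong on-block ⟩
    orientedPattern τ                 ∎)
    where
    open ≡-Reasoning
    reads : ∀ j → ∃ λ σ → ∀ i → trace (component c j) (component c′ j) (V i) ≡ flipIf σ (megaPiece j i)
    reads j = proj₂ (clique-reads-blocks j (cliques j)) (c j) (c′ j) (components-distinct assembles assembles′ h#h′ j)

    τ : Fin (suc t) → Bool
    τ = proj₁ ∘ reads

    on-block : ∀ i → trace h h′ (V i) ≡ orientedBlock τ i
    on-block i = begin
      trace h h′ (V i)
        ≡⟨ trace-cong (V i) (λ v v∈Vi → assembled-on-block assembles v∈Vi , assembled-on-block assembles′ v∈Vi) ⟩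
      trace (component c (π i)) (component c′ (π i)) (V i)  ≡⟨ proj₂ (reads (π i)) i ⟩
      flipIf (τ (π i)) (megaPiece (π i) i)                   ≡⟨ cong (flipIf (τ (π i))) (megaPiece-own i) ⟩
      orientedBlock τ i                                      ∎

  hEdges-pattern : ∀ {h h′} → IsHEdge K h → IsHEdge K h′ → Disjoint h h′ → ∃ λ Q → CP bs π Q × HasPattern h h′ Q
  hEdges-pattern H H′ h#h′ with hEdges-oriented H H′ h#h′
  ... | τ , hh′≡τ with orientedPattern-∈C τ
  ...   | Q , Q∈C , oriented =
    Q , Q∈C , pattern-by-orientation h#h′ (map⊎ (trans hh′≡τ) (trans (cong (map swapL) hh′≡τ)) oriented)

  blowEdges-pattern : ∀ {ℓ g g′} → IsBlowEdge ℓ K g → IsBlowEdge ℓ K g′ → Separated ℓ g g′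
                    → ∃ λ Q → CP bs π Q × HasPattern g g′ Q
  blowEdges-pattern (h , H , h~g) (h′ , H′ , h′~g′) sep with hEdges-pattern H H′ (separated⇒disjoint h~g h′~g′ sep)
  ... | Q , Q∈C , hh′∼Q =
    Q , Q∈C , map⊎ (trans (pairWord-blowUp h~g h′~g′ sep)) (trans (pairWord-blowUp h′~g′ h~g (Separated-sym sep))) hh′∼Q

mainTheorem16 : (r k ℓ : ℕ) → 2 ≤ r → 2 ≤ k → 2 ≤ ℓ
    → (P : Word) → IsPattern r P
    → (bs : List Block) → IsSplit P bs → (∀ bs′ → IsSplit P bs′ → bs′ ≡ bs)
    → (t : ℕ) (π : Fin (length bs) → Fin (suc t))
    → (∀ j → ∃ λ i → π i ≡ j)
    → (∀ i → toℕ i ≡ 0 → π i ≡ zero)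
    → (K : Fin (suc t) → List Edge)
    → (∀ j → IsCliqueOn k (megaBlock bs π j) (rj bs π j) (InU k bs π j) (K j))
    → (M : List Edge) → IsMatching M → All (IsBlowEdge ℓ K) M → IsScattered ℓ M
    → IsClique (CP bs π) M
mainTheorem16 _ k ℓ _ _ _ _ _ bs (blocks-nonempty , _) _ t π surjective _ K cliques M matching blowUp scattered a b a≢b =
  blowEdges-pattern (lookupAll blowUp (∈-lookup a)) (lookupAll blowUp (∈-lookup b)) (scattered⇒separated matching scattered a≢b)
  where open HEdges k bs π surjective blocks-nonempty K cliques
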